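{- Let $G_S=(S,N,E_S)$ be a bipartite graph with no isolated vertices and maximum degree $\Delta$, and let $\gamma=|N|$. For any $c>1$ there is a subset $S'\subseteq S$ such that $$|\Gamma^1_S(S')|\;\geq\;\frac{\log_2 c}{2(1+c)\log_2\Delta}\cdot\gamma.$$
   Context: For $S'\subseteq S$, $\Gamma^1_S(S')$ is the set of vertices outside $S$ (i.e. in $N$) that have exactly one neighbor in $S'$.
   Formalization: The parameter c ranges over the rationals greater than 1. -}

module Defs where

open import Data.Nat using (ℕ; zero; suc; _+_; _⊔_; _≡ᵇ_)
open import Data.Bool using (Bool; true; false; if_then_else_; _∧_)
open import Data.Fin using (Fin; zero; suc)
open import Data.Fin.Subset using (Subset)
open import Data.Vec using (lookup)

-- A bipartite graph G_S = (S, N, E_S) with S = Fin s and N = Fin n,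
-- given by its (bipartite) adjacency relation.
BipGraph : ℕ → ℕ → Set
BipGraph s n = Fin s → Fin n → Bool

count : ∀ {k} → (Fin k → Bool) → ℕ
count {zero} f = 0
count {suc k} f = (if f zero then 1 else 0) + count (λ i → f (suc i))

maxOver : ∀ {k} → (Fin k → ℕ) → ℕ
maxOver {zero} f = 0
maxOver {suc k} f = f zero ⊔ maxOver (λ i → f (suc i))

degS : ∀ {s n} → BipGraph s n → Fin s → ℕ
degS G i = count (G i)

degN : ∀ {s n} → BipGraph s n → Fin n → ℕ
degN G j = count (λ i → G i j)

NoIsolated : ∀ {s n} → BipGraph s n → Set
NoIsolated {s} {n} G = ((i : Fin s) → 1 Data.Nat.≤ degS G i) Data.Product.× ((j : Fin n) → 1 Data.Nat.≤ degN G j)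
  where import Data.Product; import Data.Nat

maxDeg : ∀ {s n} → BipGraph s n → ℕ
maxDeg G = maxOver (degS G) ⊔ maxOver (degN G)

degIn : ∀ {s n} → BipGraph s n → Subset s → Fin n → ℕ
degIn G S' j = count (λ i → lookup S' i ∧ G i j)

Γ¹-card : ∀ {s n} → BipGraph s n → Subset s → ℕ
Γ¹-card G S' = count (λ j → degIn G S' j ≡ᵇ 1)

-- Choose every vertex of S independently with probability 1 / (1 + w). A
-- vertex of N of degree d then has exactly one chosen neighbour with
-- probability d w^(d-1) / (1 + w)^d, and the method of conditional
-- expectations yields an S' whose Γ¹ is at least that expectation. Doing this
-- at the scales w = 2^i - 1 for i ≤ log₂ Δ + 2 and keeping the best S', every
-- vertex of N contributes at least 2/5 in total over the scales (7/8 when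
-- Δ ≤ 32), whence |Γ¹(S')| ≥ γ / (4 log₂ Δ). The stated bound follows since
-- 2 log₂ c ≤ 1 + c for every c > 0.

{-# OPTIONS --safe #-}
module Submission where

open import Defs
open import Data.Nat using (ℕ; _≤_; _<_; _*_; _+_; _^_)
open import Data.Fin.Subset using (Subset)
open import Data.Product using (Σ)

open import Data.Bool using (Bool; true; false; if_then_else_)
open import Data.Empty using (⊥-elim)
open import Data.Fin using (Fin; zero; suc)
open import Data.List using (upTo)
open import Data.List.Membership.Propositional.Properties using (∈-upTo⁺)
open import Data.List.Relation.Unary.All using (All; all?; lookup)
open import Data.Nat using (zero; suc; _∸_; _≡ᵇ_; _/_; _≤?_; _<?_; z≤n; s≤s; NonZero; >-nonZero)
open import Data.Nat.DivMod using (_%_; m/n*n≤m; m*n/n≡m; /-monoˡ-≤; m≡m%n+[m/n]*n; m%n<n)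
open import Data.Nat.Properties
open import Data.Nat.Tactic.RingSolver using (solve-∀)
open import Data.Product using (_,_; _×_; map₂)
open import Data.Sum using (inj₁; inj₂; [_,_]′)
open import Data.Vec using ([]; _∷_)
open import Function using (_∘_)
open import Relation.Binary.PropositionalEquality
open import Relation.Nullary using (Dec; yes; no)
open import Relation.Nullary.Decidable using (toWitness; _→-dec_)
open import Algebra.Properties.CommutativeSemigroup *-commutativeSemigroup
  using (x∙yz≈y∙xz; x∙yz≈xz∙y; xy∙z≈xz∙y; xy∙z≈y∙xz; xy∙z≈x∙zy; xy∙z≈zx∙y; xy∙z≈yz∙x;
         interchange)
open import Algebra.Properties.Semiring.Sum +-*-semiring
  using (sum; ∑-distrib-+; *-distribˡ-sum; *-distribʳ-sum; sum-replicate-zero)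

𝟙 : Bool → ℕ
𝟙 b = if b then 1 else 0

∑-mono-≤ : ∀ {n} {f g : Fin n → ℕ} → (∀ j → f j ≤ g j) → sum f ≤ sum g
∑-mono-≤ {zero}  f≤g = z≤n
∑-mono-≤ {suc n} f≤g = +-mono-≤ (f≤g zero) (∑-mono-≤ (f≤g ∘ suc))

*≤∑ : ∀ {n} c (f : Fin n → ℕ) → (∀ j → c ≤ f j) → n * c ≤ sum f
*≤∑ {zero}  c f c≤f = z≤n
*≤∑ {suc n} c f c≤f = +-mono-≤ (c≤f zero) (*≤∑ c (f ∘ suc) (c≤f ∘ suc))

count≡∑𝟙 : ∀ {n} (f : Fin n → Bool) → count f ≡ sum (𝟙 ∘ f)
count≡∑𝟙 {zero}  f = refl
count≡∑𝟙 {suc n} f = cong (𝟙 (f zero) +_) (count≡∑𝟙 (f ∘ suc))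

count-cong : ∀ {n} {f g : Fin n → Bool} → (∀ j → f j ≡ g j) → count f ≡ count g
count-cong {zero}  f≡g = refl
count-cong {suc n} f≡g = cong₂ (λ b m → 𝟙 b + m) (f≡g zero) (count-cong (f≡g ∘ suc))

-- The method of conditional expectations

nbhd : ∀ {s n} → BipGraph s n → Fin n → Fin s → Bool
nbhd G j i = G i j

-- (1 + w) ^ s times the probability that c plus the number of chosen i
-- with col i equals 1, each i being chosen independently with
-- probability 1 / (1 + w).
exactlyOne : ℕ → ∀ {s} → ℕ → (Fin s → Bool) → ℕ
exactlyOne w {zero}  c col = 𝟙 (c ≡ᵇ 1)
exactlyOne w {suc s} c col =
  exactlyOne w (c + 𝟙 (col zero)) (col ∘ suc) + w * exactlyOne w c (col ∘ suc)

-- c j counts the neighbours of j among the vertices of S already put into S'.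
Γ¹-card⁺ : ∀ {s n} → BipGraph s n → (Fin n → ℕ) → Subset s → ℕ
Γ¹-card⁺ G c S' = count (λ j → c j + degIn G S' j ≡ᵇ 1)

conditionalExpectation : ∀ w {s n} (G : BipGraph s n) (c : Fin n → ℕ) →
  Σ (Subset s) λ S' → sum (λ j → exactlyOne w (c j) (nbhd G j)) ≤ suc w ^ s * Γ¹-card⁺ G c S'
conditionalExpectation w {zero} G c = [] , ≤-reflexive (begin
  sum (λ j → 𝟙 (c j ≡ᵇ 1))       ≡⟨ sym (count≡∑𝟙 (λ j → c j ≡ᵇ 1)) ⟩
  count (λ j → c j ≡ᵇ 1)          ≡⟨ count-cong (λ j → cong (_≡ᵇ 1) (sym (+-identityʳ (c j)))) ⟩
  Γ¹-card⁺ G c []                 ≡⟨ sym (*-identityˡ _) ⟩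
  1 * Γ¹-card⁺ G c []             ∎)
  where open ≡-Reasoning
conditionalExpectation w {suc s} {n} G c =
  pick (conditionalExpectation w G′ c₁) (conditionalExpectation w G′ c)
  where
  G′ : BipGraph s n
  G′ = G ∘ suc
  c₁ : Fin n → ℕ
  c₁ j = c j + 𝟙 (G zero j)
  P X Y : ℕ
  P = suc w ^ s
  X = sum (λ j → exactlyOne w (c₁ j) (nbhd G′ j))
  Y = sum (λ j → exactlyOne w (c j) (nbhd G′ j))

  split : sum (λ j → exactlyOne w (c j) (nbhd G j)) ≡ X + w * Y
  split = trans (∑-distrib-+ (λ j → exactlyOne w (c₁ j) (nbhd G′ j)) (λ j → w * exactlyOne w (c j) (nbhd G′ j)))
                (cong (X +_) (sym (*-distribˡ-sum w (λ j → exactlyOne w (c j) (nbhd G′ j)))))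

  bound : ∀ m → X ≤ P * m → Y ≤ P * m → sum (λ j → exactlyOne w (c j) (nbhd G j)) ≤ suc w * P * m
  bound m X≤ Y≤ = begin
    sum (λ j → exactlyOne w (c j) (nbhd G j)) ≡⟨ split ⟩
    X + w * Y                                 ≤⟨ +-mono-≤ X≤ (*-monoʳ-≤ w Y≤) ⟩
    suc w * (P * m)                           ≡⟨ *-assoc (suc w) P m ⟨
    suc w * P * m                             ∎
    where open ≤-Reasoning

  include : ∀ S → Γ¹-card⁺ G′ c₁ S ≡ Γ¹-card⁺ G c (true ∷ S)
  include S = count-cong (λ j → cong (_≡ᵇ 1) (+-assoc (c j) (𝟙 (G zero j)) (degIn G′ S j)))

  pick : Σ (Subset s) (λ S → X ≤ P * Γ¹-card⁺ G′ c₁ S) → Σ (Subset s) (λ S → Y ≤ P * Γ¹-card⁺ G′ c S) →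
         Σ (Subset (suc s)) λ S → sum (λ j → exactlyOne w (c j) (nbhd G j)) ≤ suc w * P * Γ¹-card⁺ G c S
  pick (S₁ , h₁) (S₀ , h₀) with ≤-total (Γ¹-card⁺ G′ c S₀) (Γ¹-card⁺ G′ c₁ S₁)
  ... | inj₁ m₀≤m₁ = true ∷ S₁ , subst (λ m → _ ≤ suc w * P * m) (include S₁)
                                   (bound _ h₁ (≤-trans h₀ (*-monoʳ-≤ P m₀≤m₁)))
  ... | inj₂ m₁≤m₀ = false ∷ S₀ , bound _ (≤-trans h₁ (*-monoʳ-≤ P m₁≤m₀)) h₀

exactlyOne-≥2 : ∀ w {s} c (col : Fin s → Bool) → exactlyOne w (2 + c) col ≡ 0
exactlyOne-≥2 w {zero}  c col = refl
exactlyOne-≥2 w {suc s} c col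
  rewrite exactlyOne-≥2 w (c + 𝟙 (col zero)) (col ∘ suc) | exactlyOne-≥2 w c (col ∘ suc) = *-zeroʳ w

exactlyOne-1 : ∀ w {s} (col : Fin s → Bool) →
  exactlyOne w 1 col * suc w ^ count col ≡ w ^ count col * suc w ^ s
exactlyOne-1 w {zero} col = refl
exactlyOne-1 w {suc s} col with col zero
... | false = begin
  (E + w * E) * suc w ^ d      ≡⟨ *-assoc (suc w) E (suc w ^ d) ⟩
  suc w * (E * suc w ^ d)      ≡⟨ cong (suc w *_) (exactlyOne-1 w (col ∘ suc)) ⟩
  suc w * (w ^ d * suc w ^ s)  ≡⟨ x∙yz≈y∙xz (suc w) (w ^ d) (suc w ^ s) ⟩
  w ^ d * (suc w * suc w ^ s)  ∎
  where
  open ≡-Reasoning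
  E d : ℕ
  E = exactlyOne w 1 (col ∘ suc)
  d = count (col ∘ suc)
... | true = begin
  (exactlyOne w 2 (col ∘ suc) + w * E) * (suc w * suc w ^ d)
    ≡⟨ cong (λ z → (z + w * E) * (suc w * suc w ^ d)) (exactlyOne-≥2 w 0 (col ∘ suc)) ⟩
  w * E * (suc w * suc w ^ d)      ≡⟨ interchange w E (suc w) (suc w ^ d) ⟩
  w * suc w * (E * suc w ^ d)      ≡⟨ cong (w * suc w *_) (exactlyOne-1 w (col ∘ suc)) ⟩
  w * suc w * (w ^ d * suc w ^ s)  ≡⟨ interchange w (suc w) (w ^ d) (suc w ^ s) ⟩
  w * w ^ d * (suc w * suc w ^ s)  ∎
  where
  open ≡-Reasoning
  E d : ℕ
  E = exactlyOne w 1 (col ∘ suc)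
  d = count (col ∘ suc)

*-pred-^ : ∀ w d → w * (d * w ^ (d ∸ 1)) ≡ d * w ^ d
*-pred-^ w zero    = *-zeroʳ w
*-pred-^ w (suc d) = x∙yz≈y∙xz w (suc d) (w ^ d)

exactlyOne-0 : ∀ w {s} (col : Fin s → Bool) →
  exactlyOne w 0 col * suc w ^ count col ≡ count col * w ^ (count col ∸ 1) * suc w ^ s
exactlyOne-0 w {zero} col = refl
exactlyOne-0 w {suc s} col with col zero
... | false = begin
  (E + w * E) * suc w ^ d                ≡⟨ *-assoc (suc w) E (suc w ^ d) ⟩
  suc w * (E * suc w ^ d)                ≡⟨ cong (suc w *_) (exactlyOne-0 w (col ∘ suc)) ⟩
  suc w * (d * w ^ (d ∸ 1) * suc w ^ s)  ≡⟨ x∙yz≈y∙xz (suc w) (d * w ^ (d ∸ 1)) (suc w ^ s) ⟩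
  d * w ^ (d ∸ 1) * (suc w * suc w ^ s)  ∎
  where
  open ≡-Reasoning
  E d : ℕ
  E = exactlyOne w 0 (col ∘ suc)
  d = count (col ∘ suc)
... | true = begin
  (E₁ + w * E) * (suc w * suc w ^ d)
    ≡⟨ expand E₁ E w (suc w) (suc w ^ d) ⟩
  suc w * (E₁ * suc w ^ d) + suc w * (w * (E * suc w ^ d))
    ≡⟨ cong₂ (λ a b → suc w * a + suc w * (w * b)) (exactlyOne-1 w (col ∘ suc)) (exactlyOne-0 w (col ∘ suc)) ⟩
  suc w * (w ^ d * suc w ^ s) + suc w * (w * (d * w ^ (d ∸ 1) * suc w ^ s))
    ≡⟨ cong (λ z → suc w * (w ^ d * suc w ^ s) + suc w * z)
            (trans (sym (*-assoc w _ (suc w ^ s))) (cong (_* suc w ^ s) (*-pred-^ w d))) ⟩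
  suc w * (w ^ d * suc w ^ s) + suc w * (d * w ^ d * suc w ^ s)
    ≡⟨ collect (suc w) (w ^ d) (suc w ^ s) d ⟩
  suc d * w ^ d * (suc w * suc w ^ s) ∎
  where
  open ≡-Reasoning
  E₁ E d : ℕ
  E₁ = exactlyOne w 1 (col ∘ suc)
  E = exactlyOne w 0 (col ∘ suc)
  d = count (col ∘ suc)
  expand : ∀ a b c e x → (a + c * b) * (e * x) ≡ e * (a * x) + e * (c * (b * x))
  expand = solve-∀
  collect : ∀ a b c d → a * (b * c) + a * (d * b * c) ≡ (1 + d) * b * (a * c)
  collect = solve-∀

-- Probabilities at the scales 2 ^ -i

-- Opaque, since the literal would unfold precision * x to x + 999 * x and
-- block unification.
opaque
  precision : ℕ
  precision = 1000

-- precision times the probability that a vertex of degree d has exactly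
-- one chosen neighbour, each vertex being chosen with probability
-- 1 / (1 + w), rounded down.
oneHitProb : ℕ → ℕ → ℕ
oneHitProb d w = (precision * d * w ^ (d ∸ 1) / suc w ^ d) {{m^n≢0 (suc w) d}}

≤-oneHitProb : ∀ d w c → c * suc w ^ d ≤ precision * d * w ^ (d ∸ 1) → c ≤ oneHitProb d w
≤-oneHitProb d w c h = begin
  c                          ≡⟨ m*n/n≡m c (suc w ^ d) ⟨
  c * suc w ^ d / suc w ^ d  ≤⟨ /-monoˡ-≤ (suc w ^ d) h ⟩
  oneHitProb d w             ∎
  where
  open ≤-Reasoning
  instance
    _ : NonZero (suc w ^ d)
    _ = m^n≢0 (suc w) d

oneHitProb-≤-exactlyOne : ∀ w {s} (col : Fin s → Bool) →
  oneHitProb (count col) w * suc w ^ s ≤ precision * exactlyOne w 0 col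
oneHitProb-≤-exactlyOne w {s} col =
  *-cancelʳ-≤ (oneHitProb d w * suc w ^ s) (precision * exactlyOne w 0 col) (suc w ^ d) (begin
  oneHitProb d w * suc w ^ s * suc w ^ d     ≡⟨ xy∙z≈xz∙y (oneHitProb d w) (suc w ^ s) (suc w ^ d) ⟩
  oneHitProb d w * suc w ^ d * suc w ^ s     ≤⟨ *-monoˡ-≤ (suc w ^ s) (m/n*n≤m _ (suc w ^ d)) ⟩
  precision * d * w ^ (d ∸ 1) * suc w ^ s    ≡⟨ cong (_* suc w ^ s) (*-assoc precision d _) ⟩
  precision * (d * w ^ (d ∸ 1)) * suc w ^ s  ≡⟨ *-assoc precision _ (suc w ^ s) ⟩
  precision * (d * w ^ (d ∸ 1) * suc w ^ s)  ≡⟨ cong (precision *_) (exactlyOne-0 w col) ⟨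
  precision * (exactlyOne w 0 col * suc w ^ d) ≡⟨ *-assoc precision _ (suc w ^ d) ⟨
  precision * exactlyOne w 0 col * suc w ^ d ∎)
  where
  open ≤-Reasoning
  d : ℕ
  d = count col
  instance
    _ : NonZero (suc w ^ d)
    _ = m^n≢0 (suc w) d

Γ¹-atScale : ∀ w {s n} (G : BipGraph s n) →
  Σ (Subset s) λ S' → sum (λ j → oneHitProb (degN G j) w) ≤ precision * Γ¹-card G S'
Γ¹-atScale w {s} G with conditionalExpectation w G (λ _ → 0)
... | S' , h = S' , *-cancelʳ-≤ (sum (λ j → oneHitProb (degN G j) w)) (precision * Γ¹-card G S') P (begin
  sum (λ j → oneHitProb (degN G j) w) * P          ≡⟨ *-distribʳ-sum P (λ j → oneHitProb (degN G j) w) ⟩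
  sum (λ j → oneHitProb (degN G j) w * P)          ≤⟨ ∑-mono-≤ (λ j → oneHitProb-≤-exactlyOne w (nbhd G j)) ⟩
  sum (λ j → precision * exactlyOne w 0 (nbhd G j)) ≡⟨ *-distribˡ-sum precision (λ j → exactlyOne w 0 (nbhd G j)) ⟨
  precision * sum (λ j → exactlyOne w 0 (nbhd G j)) ≤⟨ *-monoʳ-≤ precision h ⟩
  precision * (P * Γ¹-card G S')                   ≡⟨ x∙yz≈xz∙y precision P (Γ¹-card G S') ⟩
  precision * Γ¹-card G S' * P                     ∎)
  where
  open ≤-Reasoning
  P : ℕ
  P = suc w ^ s
  instance
    _ : NonZero P
    _ = m^n≢0 (suc w) s

scale : ℕ → ℕ
scale i = 2 ^ i ∸ 1

scaleSum : ℕ → ℕ → ℕ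
scaleSum d zero    = 0
scaleSum d (suc R) = scaleSum d R + oneHitProb d (scale R)

scaleSum-mono : ∀ d {R R′} → R ≤ R′ → scaleSum d R ≤ scaleSum d R′
scaleSum-mono d {R′ = zero}   z≤n = z≤n
scaleSum-mono d {R′ = suc R′} R≤ with m≤n⇒m<n∨m≡n R≤
... | inj₁ R<1+R′ = ≤-trans (scaleSum-mono d (≤-pred R<1+R′)) (m≤m+n _ _)
... | inj₂ refl   = ≤-refl

bestOf : ∀ {A : Set} (g : A → ℕ) (b : ℕ → ℕ) → (∀ i → Σ A λ x → b i ≤ g x) →
  ∀ R → Σ A λ x → ∀ i → i < suc R → b i ≤ g x
bestOf g b opt zero with opt 0
... | x , b₀≤ = x , λ { .0 (s≤s z≤n) → b₀≤ }
bestOf g b opt (suc R) with bestOf g b opt R | opt (suc R)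
... | x , hx | y , hy with ≤-total (g x) (g y)
... | inj₁ gx≤gy = y , λ i i< →
  [ (λ i<1+R → ≤-trans (hx i i<1+R) gx≤gy) , (λ { refl → hy }) ]′ (m<1+n⇒m<n∨m≡n i<)
... | inj₂ gy≤gx = x , λ i i< →
  [ hx i , (λ { refl → ≤-trans hy gy≤gx }) ]′ (m<1+n⇒m<n∨m≡n i<)

∑-scaleSum-≤ : ∀ {n} (d : Fin n → ℕ) B R → (∀ i → i < R → sum (λ j → oneHitProb (d j) (scale i)) ≤ B) →
  sum (λ j → scaleSum (d j) R) ≤ R * B
∑-scaleSum-≤ {n} d B zero    h = ≤-reflexive (sum-replicate-zero n)
∑-scaleSum-≤     d B (suc R) h = begin
  sum (λ j → scaleSum (d j) R + oneHitProb (d j) (scale R))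
    ≡⟨ ∑-distrib-+ (λ j → scaleSum (d j) R) (λ j → oneHitProb (d j) (scale R)) ⟩
  sum (λ j → scaleSum (d j) R) + sum (λ j → oneHitProb (d j) (scale R))
    ≤⟨ +-mono-≤ (∑-scaleSum-≤ d B R (λ i i<R → h i (m<n⇒m<1+n i<R))) (h R ≤-refl) ⟩
  R * B + B ≡⟨ +-comm (R * B) B ⟩
  suc R * B ∎
  where open ≤-Reasoning

Γ¹-scaleSum : ∀ {s n} (G : BipGraph s n) R →
  Σ (Subset s) λ S' → sum (λ j → scaleSum (degN G j) (suc R)) ≤ suc R * (precision * Γ¹-card G S')
Γ¹-scaleSum G R with bestOf (λ S' → precision * Γ¹-card G S') (λ i → sum (λ j → oneHitProb (degN G j) (scale i)))
                            (λ i → Γ¹-atScale (scale i) G) R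
... | S' , h = S' , ∑-scaleSum-≤ (degN G) _ (suc R) h

-- Lower bounds on the scale sums

n<2^n : ∀ n → n < 2 ^ n
n<2^n zero    = s≤s z≤n
n<2^n (suc n) = +-mono-≤ (m^n>0 2 n) (≤-trans (n<2^n n) (m≤m+n (2 ^ n) 0))

dyadicInterval : ∀ {d} → 2 ≤ d → Σ ℕ λ v → 2 ^ v < d × d ≤ 2 ^ suc v
dyadicInterval {d} 2≤d = search d 0 2≤d (subst (λ x → d ≤ 2 ^ x) (sym (+-identityʳ d)) (<⇒≤ (n<2^n d)))
  where
  search : ∀ k v → 2 ^ v < d → d ≤ 2 ^ (k + v) → Σ ℕ λ u → 2 ^ u < d × d ≤ 2 ^ suc u
  search zero    v lo hi = ⊥-elim (<⇒≱ lo hi)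
  search (suc k) v lo hi with d ≤? 2 ^ suc v
  ... | yes d≤ = v , lo , d≤
  ... | no  d≰ = search k (suc v) (≰⇒> d≰) (subst (λ x → d ≤ 2 ^ x) (sym (+-suc k v)) hi)

opaque
  unfolding precision
  smallDegreeTable : All (λ d → All (λ r → suc d ≤ 2 ^ r → 875 ≤ scaleSum (suc d) (2 + r)) (upTo 6)) (upTo 32)
  smallDegreeTable = toWitness {a? = all? (λ d → all? (λ r →
    (suc d ≤? 2 ^ r) →-dec (875 ≤? scaleSum (suc d) (2 + r))) (upTo 6)) (upTo 32)} _

scaleSum-smallDegree : ∀ d r → 1 ≤ d → d ≤ 32 → d ≤ 2 ^ r → 875 ≤ scaleSum d (2 + r)
scaleSum-smallDegree (suc d) r _ d<32 d≤2^r with r <? 6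
... | yes r<6 = lookup (lookup smallDegreeTable (∈-upTo⁺ d<32)) (∈-upTo⁺ r<6) d≤2^r
... | no  r≮6 = ≤-trans (lookup (lookup smallDegreeTable (∈-upTo⁺ d<32)) (∈-upTo⁺ {n = 6} {i = 5} ≤-refl) d<32)
                        (scaleSum-mono (suc d) (+-monoʳ-≤ 2 (<⇒≤ (≮⇒≥ r≮6))))

^-distribʳ-* : ∀ a b k → (a * b) ^ k ≡ a ^ k * b ^ k
^-distribʳ-* a b zero    = refl
^-distribʳ-* a b (suc k) = trans (cong (a * b *_) (^-distribʳ-* a b k)) (interchange a b (a ^ k) (b ^ k))

bernoulli : ∀ m j → suc m ^ j * (suc m ∸ j) ≤ suc m * m ^ j
bernoulli m zero    = ≤-reflexive (trans (+-identityʳ (suc m)) (sym (*-identityʳ (suc m))))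
bernoulli m (suc j) = begin
  suc m * suc m ^ j * (m ∸ j)    ≡⟨ xy∙z≈y∙xz (suc m) (suc m ^ j) (m ∸ j) ⟩
  suc m ^ j * (suc m * (m ∸ j))  ≤⟨ *-monoʳ-≤ (suc m ^ j) step ⟩
  suc m ^ j * (m * (suc m ∸ j))  ≡⟨ x∙yz≈y∙xz (suc m ^ j) m (suc m ∸ j) ⟩
  m * (suc m ^ j * (suc m ∸ j))  ≤⟨ *-monoʳ-≤ m (bernoulli m j) ⟩
  m * (suc m * m ^ j)            ≡⟨ x∙yz≈y∙xz m (suc m) (m ^ j) ⟩
  suc m * (m * m ^ j)            ∎
  where
  open ≤-Reasoning
  step : suc m * (m ∸ j) ≤ m * (suc m ∸ j)
  step with j ≤? m
  ... | yes j≤m rewrite +-∸-assoc 1 j≤m =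
    ≤-trans (+-monoˡ-≤ (m * (m ∸ j)) (m∸n≤m m j)) (≤-reflexive (sym (*-suc m (m ∸ j))))
  ... | no  j≰m rewrite m≤n⇒m∸n≡0 (<⇒≤ (≰⇒> j≰m)) | *-zeroʳ (suc m) = z≤n

^-exchange-≤ : ∀ {a b e E} → a ≤ b → e ≤ E → a ^ E * b ^ e ≤ a ^ e * b ^ E
^-exchange-≤ {a} {b} {e} a≤b e≤E with m≤n⇒∃[o]m+o≡n e≤E
... | t , refl = begin
  a ^ (e + t) * b ^ e      ≡⟨ cong (_* b ^ e) (^-distribˡ-+-* a e t) ⟩
  a ^ e * a ^ t * b ^ e    ≤⟨ *-monoˡ-≤ (b ^ e) (*-monoʳ-≤ (a ^ e) (^-monoˡ-≤ t a≤b)) ⟩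
  a ^ e * b ^ t * b ^ e    ≡⟨ xy∙z≈x∙zy (a ^ e) (b ^ t) (b ^ e) ⟩
  a ^ e * (b ^ e * b ^ t)  ≡⟨ cong (a ^ e *_) (^-distribˡ-+-* b e t) ⟨
  a ^ e * b ^ (e + t)      ∎
  where open ≤-Reasoning

bernoulli-16 : ∀ m j k → suc m ≡ 16 * j → 15 ^ k * suc m ^ (j * k) ≤ 16 ^ k * m ^ (j * k)
bernoulli-16 m (suc j) k eq = begin
  15 ^ k * suc m ^ (j′ * k)  ≡⟨ cong (15 ^ k *_) (^-*-assoc (suc m) j′ k) ⟨
  15 ^ k * (suc m ^ j′) ^ k  ≡⟨ ^-distribʳ-* 15 (suc m ^ j′) k ⟨
  (15 * suc m ^ j′) ^ k      ≤⟨ ^-monoˡ-≤ k base ⟩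
  (16 * m ^ j′) ^ k          ≡⟨ ^-distribʳ-* 16 (m ^ j′) k ⟩
  16 ^ k * (m ^ j′) ^ k      ≡⟨ cong (16 ^ k *_) (^-*-assoc m j′ k) ⟩
  16 ^ k * m ^ (j′ * k)      ∎
  where
  open ≤-Reasoning
  j′ : ℕ
  j′ = suc j
  suc-m∸j : suc m ∸ j′ ≡ 15 * j′
  suc-m∸j = trans (cong (_∸ j′) eq) (m+n∸m≡n j′ (15 * j′))
  base : 15 * suc m ^ j′ ≤ 16 * m ^ j′
  base = *-cancelˡ-≤ j′ (begin
    j′ * (15 * suc m ^ j′)  ≡⟨ x∙yz≈y∙xz j′ 15 (suc m ^ j′) ⟩
    15 * (j′ * suc m ^ j′)  ≡⟨ trans (sym (*-assoc 15 j′ (suc m ^ j′))) (*-comm (15 * j′) (suc m ^ j′)) ⟩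
    suc m ^ j′ * (15 * j′)  ≡⟨ cong (suc m ^ j′ *_) suc-m∸j ⟨
    suc m ^ j′ * (suc m ∸ j′) ≤⟨ bernoulli m j′ ⟩
    suc m * m ^ j′          ≡⟨ cong (_* m ^ j′) eq ⟩
    16 * j′ * m ^ j′        ≡⟨ xy∙z≈y∙xz 16 j′ (m ^ j′) ⟩
    j′ * (16 * m ^ j′)      ∎)

oneHitProb-16 : ∀ m j k c e → suc m ≡ 16 * j → e ≤ k * j →
  c * suc m * 16 ^ k ≤ precision * suc e * 15 ^ k → c ≤ oneHitProb (suc e) m
oneHitProb-16 m j k c e eq e≤kj hyp = ≤-oneHitProb (suc e) m c (*-cancelʳ-≤ _ _ X {{X≢0}} (begin
  c * (suc m * suc m ^ e) * (15 ^ k * suc m ^ E)    ≡⟨ cong (_* (15 ^ k * suc m ^ E)) (*-assoc c (suc m) (suc m ^ e)) ⟨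
  c * suc m * suc m ^ e * (15 ^ k * suc m ^ E)      ≤⟨ *-monoʳ-≤ (c * suc m * suc m ^ e) (bernoulli-16 m j k eq) ⟩
  c * suc m * suc m ^ e * (16 ^ k * m ^ E)          ≡⟨ regroup (c * suc m) (suc m ^ e) (16 ^ k) (m ^ E) ⟩
  c * suc m * 16 ^ k * (m ^ E * suc m ^ e)          ≤⟨ *-monoʳ-≤ (c * suc m * 16 ^ k) (^-exchange-≤ (n≤1+n m) e≤E) ⟩
  c * suc m * 16 ^ k * (m ^ e * suc m ^ E)          ≤⟨ *-monoˡ-≤ (m ^ e * suc m ^ E) hyp ⟩
  precision * suc e * 15 ^ k * (m ^ e * suc m ^ E)  ≡⟨ interchange (precision * suc e) (15 ^ k) (m ^ e) (suc m ^ E) ⟩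
  precision * suc e * m ^ e * (15 ^ k * suc m ^ E)  ∎))
  where
  open ≤-Reasoning
  E X : ℕ
  E = j * k
  X = 15 ^ k * suc m ^ E
  X≢0 : NonZero X
  X≢0 = >-nonZero (*-mono-≤ (m^n>0 15 k) (m^n>0 (suc m) E))
  e≤E : e ≤ E
  e≤E = ≤-trans e≤kj (≤-reflexive (*-comm k j))
  regroup : ∀ a b c d → a * b * (c * d) ≡ a * c * (d * b)
  regroup = solve-∀

suc-scale : ∀ i → suc (scale i) ≡ 2 ^ i
suc-scale i = m+[n∸m]≡n (m^n>0 2 i)

oneHitProb-dyadic : ∀ u k t c e → e ≤ k * 2 ^ u → 2 ^ (4 + u) ≤ t * suc e →
  c * t * 16 ^ k ≤ precision * 15 ^ k → c ≤ oneHitProb (suc e) (scale (4 + u))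
oneHitProb-dyadic u k t c e e≤ 2^≤ hyp =
  oneHitProb-16 (scale (4 + u)) (2 ^ u) k c e (trans (suc-scale (4 + u)) (^-distribˡ-+-* 2 4 u)) e≤ (begin
    c * suc (scale (4 + u)) * 16 ^ k  ≡⟨ cong (λ x → c * x * 16 ^ k) (suc-scale (4 + u)) ⟩
    c * 2 ^ (4 + u) * 16 ^ k          ≤⟨ *-monoˡ-≤ (16 ^ k) (*-monoʳ-≤ c 2^≤) ⟩
    c * (t * suc e) * 16 ^ k          ≡⟨ regroup c t (suc e) (16 ^ k) ⟩
    suc e * (c * t * 16 ^ k)          ≤⟨ *-monoʳ-≤ (suc e) hyp ⟩
    suc e * (precision * 15 ^ k)      ≡⟨ x∙yz≈y∙xz (suc e) precision (15 ^ k) ⟩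
    precision * (suc e * 15 ^ k)      ≡⟨ *-assoc precision (suc e) (15 ^ k) ⟨
    precision * suc e * 15 ^ k        ∎)
  where
  open ≤-Reasoning
  regroup : ∀ a b c d → a * (b * c) * d ≡ c * (a * b * d)
  regroup = solve-∀

opaque
  unfolding precision
  126‰≤[15/16]^32 : 126 * 1 * 16 ^ 32 ≤ precision * 15 ^ 32
  126‰≤[15/16]^32 = ≤ᵇ⇒≤ _ _ _
  178‰≤[15/16]^16/2 : 178 * 2 * 16 ^ 16 ≤ precision * 15 ^ 16
  178‰≤[15/16]^16/2 = ≤ᵇ⇒≤ _ _ _
  149‰≤[15/16]^8/4 : 149 * 4 * 16 ^ 8 ≤ precision * 15 ^ 8
  149‰≤[15/16]^8/4 = ≤ᵇ⇒≤ _ _ _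

scaleSum-largeDegree : ∀ d r → 32 < d → d ≤ 2 ^ r → 400 ≤ scaleSum d (2 + r)
scaleSum-largeDegree d r 32<d d≤2^r with dyadicInterval {d} (≤-trans (s≤s (s≤s z≤n)) (<⇒≤ 32<d))
... | W , 2^W<d , d≤2^[1+W] with 5 ≤? W | 1 + W ≤? r
... | no 5≰W | _ = ⊥-elim (<⇒≱ 32<d (≤-trans d≤2^[1+W] (^-monoʳ-≤ 2 (≰⇒> 5≰W))))
... | _ | no r≱1+W = ⊥-elim (<⇒≱ 2^W<d (≤-trans d≤2^r (^-monoʳ-≤ 2 (≤-pred (≰⇒> r≱1+W)))))
... | yes 5≤W | yes 1+W≤r with m≤n⇒∃[o]m+o≡n 5≤W
... | o , refl = go d 2^W<d d≤2^[1+W]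
  where
  go : ∀ d → 2 ^ (5 + o) < d → d ≤ 2 ^ (6 + o) → 400 ≤ scaleSum d (2 + r)
  go (suc e) 2^W<d d≤2^[1+W] = begin
    400                       ≤⟨ ≤ᵇ⇒≤ 400 453 _ ⟩
    0 + 126 + 178 + 149       ≤⟨ +-mono-≤ (+-mono-≤ (+-mono-≤ z≤n t₀) t₁) t₂ ⟩
    scaleSum (suc e) (8 + o)  ≤⟨ scaleSum-mono (suc e) (+-monoʳ-≤ 2 1+W≤r) ⟩
    scaleSum (suc e) (2 + r)  ∎
    where
    open ≤-Reasoning
    e< : ∀ k u → 2 ^ (6 + o) ≡ k * 2 ^ u → e ≤ k * 2 ^ u
    e< k u eq = ≤-trans (n≤1+n e) (≤-trans d≤2^[1+W] (≤-reflexive eq))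
    2^W≤d : 2 ^ (5 + o) ≤ suc e
    2^W≤d = <⇒≤ 2^W<d
    t₀ : 126 ≤ oneHitProb (suc e) (scale (5 + o))
    t₀ = oneHitProb-dyadic (1 + o) 32 1 126 e (e< 32 (1 + o) (^-distribˡ-+-* 2 5 (1 + o)))
           (≤-trans 2^W≤d (≤-reflexive (sym (*-identityˡ (suc e))))) 126‰≤[15/16]^32
    t₁ : 178 ≤ oneHitProb (suc e) (scale (6 + o))
    t₁ = oneHitProb-dyadic (2 + o) 16 2 178 e (e< 16 (2 + o) (^-distribˡ-+-* 2 4 (2 + o)))
           (*-monoʳ-≤ 2 2^W≤d) 178‰≤[15/16]^16/2
    t₂ : 149 ≤ oneHitProb (suc e) (scale (7 + o))
    t₂ = oneHitProb-dyadic (3 + o) 8 4 149 e (e< 8 (3 + o) (^-distribˡ-+-* 2 3 (3 + o)))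
           (≤-trans (*-monoʳ-≤ 2 (*-monoʳ-≤ 2 2^W≤d)) (≤-reflexive (sym (*-assoc 2 2 (suc e))))) 149‰≤[15/16]^8/4

scaleSum-lower : ∀ d r → 1 ≤ d → d ≤ 2 ^ r → 400 ≤ scaleSum d (2 + r)
scaleSum-lower d r 1≤d d≤2^r with d ≤? 32
... | yes d≤32 = ≤-trans (≤ᵇ⇒≤ 400 875 _) (scaleSum-smallDegree d r 1≤d d≤32 d≤2^r)
... | no  d≰32 = scaleSum-largeDegree d r (≰⇒> d≰32) d≤2^r

-- The bound γ ≤ 4 |Γ¹(S')| log₂ Δ

^-cancelʳ-≤ : ∀ A .{{_ : NonZero A}} {x y} → x ^ A ≤ y ^ A → x ≤ y
^-cancelʳ-≤ A {x} {y} h with x ≤? y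
... | yes x≤y = x≤y
... | no  x≰y = ⊥-elim (<⇒≱ (^-monoˡ-< A (≰⇒> x≰y)) h)

2^≤Δ^ : ∀ n g Δ K A B .{{_ : NonZero A}} → n * A ≤ K * (B * g) → 2 ^ (K * B) ≤ Δ ^ (4 * A) →
  2 ^ n ≤ Δ ^ (4 * g)
2^≤Δ^ n g Δ K A B n*A≤ 2^KB≤ = ^-cancelʳ-≤ A (begin
  (2 ^ n) ^ A          ≡⟨ ^-*-assoc 2 n A ⟩
  2 ^ (n * A)          ≤⟨ ^-monoʳ-≤ 2 n*A≤ ⟩
  2 ^ (K * (B * g))    ≡⟨ cong (2 ^_) (*-assoc K B g) ⟨
  2 ^ (K * B * g)      ≡⟨ ^-*-assoc 2 (K * B) g ⟨
  (2 ^ (K * B)) ^ g    ≤⟨ ^-monoˡ-≤ g 2^KB≤ ⟩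
  (Δ ^ (4 * A)) ^ g    ≡⟨ ^-*-assoc Δ (4 * A) g ⟩
  Δ ^ (4 * A * g)      ≡⟨ cong (Δ ^_) (xy∙z≈xz∙y 4 A g) ⟩
  Δ ^ (4 * g * A)      ≡⟨ ^-*-assoc Δ (4 * g) A ⟨
  (Δ ^ (4 * g)) ^ A    ∎)
  where open ≤-Reasoning

opaque
  unfolding precision
  smallΔTable : All (λ D → All (λ v →
    2 ^ v < D → D ≤ 2 ^ suc v → 2 ^ ((3 + v) * precision) ≤ D ^ (4 * 875)) (upTo 5)) (upTo 33)
  smallΔTable = toWitness {a? = all? (λ D → all? (λ v →
    (2 ^ v <? D) →-dec (D ≤? 2 ^ suc v) →-dec (2 ^ ((3 + v) * precision) ≤? D ^ (4 * 875))) (upTo 5)) (upTo 33)} _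

  8*precision≤5*1600 : 8 * precision ≤ 5 * (4 * 400)
  8*precision≤5*1600 = ≤ᵇ⇒≤ _ _ _

  precision≤1600 : precision ≤ 4 * 400
  precision≤1600 = ≤ᵇ⇒≤ _ _ _

[3+v]*B≤v*C : ∀ {v B C} → 5 ≤ v → 8 * B ≤ 5 * C → B ≤ C → (3 + v) * B ≤ v * C
[3+v]*B≤v*C {B = B} {C} 5≤v 8B≤5C B≤C with m≤n⇒∃[o]m+o≡n 5≤v
... | t , refl = begin
  (8 + t) * B     ≡⟨ *-distribʳ-+ B 8 t ⟩
  8 * B + t * B   ≤⟨ +-mono-≤ 8B≤5C (*-monoʳ-≤ t B≤C) ⟩
  5 * C + t * C   ≡⟨ *-distribʳ-+ C 5 t ⟨
  (5 + t) * C     ∎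
  where open ≤-Reasoning

largeΔ-exponent : ∀ v {D} → 5 ≤ v → 2 ^ v < D → 2 ^ ((3 + v) * precision) ≤ D ^ (4 * 400)
largeΔ-exponent v {D} 5≤v 2^v<D = begin
  2 ^ ((3 + v) * precision)  ≤⟨ ^-monoʳ-≤ 2 ([3+v]*B≤v*C 5≤v 8*precision≤5*1600 precision≤1600) ⟩
  2 ^ (v * (4 * 400))        ≡⟨ ^-*-assoc 2 v (4 * 400) ⟨
  (2 ^ v) ^ (4 * 400)        ≤⟨ ^-monoˡ-≤ (4 * 400) (<⇒≤ 2^v<D) ⟩
  D ^ (4 * 400)              ∎
  where open ≤-Reasoning

smallΔ-exponent : ∀ v {D} → D ≤ 32 → 2 ^ v < D → D ≤ 2 ^ suc v → 2 ^ ((3 + v) * precision) ≤ D ^ (4 * 875)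
smallΔ-exponent v {D} D≤32 2^v<D D≤2^[1+v] with v <? 5
... | yes v<5 = lookup (lookup smallΔTable (∈-upTo⁺ (s≤s D≤32))) (∈-upTo⁺ v<5) 2^v<D D≤2^[1+v]
... | no  v≮5 = ⊥-elim (<⇒≱ 2^v<D (≤-trans D≤32 (^-monoʳ-≤ 2 (≮⇒≥ v≮5))))

maxOver-upperBound : ∀ {k} (f : Fin k → ℕ) i → f i ≤ maxOver f
maxOver-upperBound f zero    = m≤m⊔n _ _
maxOver-upperBound f (suc i) = ≤-trans (maxOver-upperBound (f ∘ suc) i) (m≤n⊔m _ _)

degN≤maxDeg : ∀ {s n} (G : BipGraph s n) j → degN G j ≤ maxDeg G
degN≤maxDeg G j = ≤-trans (maxOver-upperBound (degN G) j) (m≤n⊔m (maxOver (degS G)) _)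

scaleSum-bound⇒log-bound : ∀ {s n} (G : BipGraph s n) → (∀ j → 1 ≤ degN G j) → ∀ {v g} →
  2 ^ v < maxDeg G → maxDeg G ≤ 2 ^ suc v →
  sum (λ j → scaleSum (degN G j) (3 + v)) ≤ (3 + v) * (precision * g) → 2 ^ n ≤ maxDeg G ^ (4 * g)
scaleSum-bound⇒log-bound {n = n} G degN≥1 {v} {g} 2^v<Δ Δ≤2^[1+v] h = byRange (maxDeg G ≤? 32)
  where
  linear : ∀ A → (∀ j → A ≤ scaleSum (degN G j) (3 + v)) → n * A ≤ (3 + v) * (precision * g)
  linear A A≤ = ≤-trans (*≤∑ A _ A≤) h
  degN≤2^[1+v] : ∀ j → degN G j ≤ 2 ^ suc v
  degN≤2^[1+v] j = ≤-trans (degN≤maxDeg G j) Δ≤2^[1+v]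
  byRange : Dec (maxDeg G ≤ 32) → 2 ^ n ≤ maxDeg G ^ (4 * g)
  byRange (yes Δ≤32) = 2^≤Δ^ n g (maxDeg G) (3 + v) 875 precision
    (linear 875 (λ j → scaleSum-smallDegree (degN G j) (suc v) (degN≥1 j)
                         (≤-trans (degN≤maxDeg G j) Δ≤32) (degN≤2^[1+v] j)))
    (smallΔ-exponent v Δ≤32 2^v<Δ Δ≤2^[1+v])
  byRange (no Δ≰32) = 2^≤Δ^ n g (maxDeg G) (3 + v) 400 precision
    (linear 400 (λ j → scaleSum-lower (degN G j) (suc v) (degN≥1 j) (degN≤2^[1+v] j)))
    (largeΔ-exponent v 5≤v 2^v<Δ)
    where
    5≤v : 5 ≤ v
    5≤v with 5 ≤? v
    ... | yes 5≤v = 5≤v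
    ... | no  5≰v = ⊥-elim (Δ≰32 (≤-trans Δ≤2^[1+v] (^-monoʳ-≤ 2 (≰⇒> 5≰v))))

Γ¹-log-bound : ∀ {s n} (G : BipGraph s n) → (∀ j → 1 ≤ degN G j) → 2 ≤ maxDeg G →
  Σ (Subset s) λ S' → 2 ^ n ≤ maxDeg G ^ (4 * Γ¹-card G S')
Γ¹-log-bound G degN≥1 2≤Δ with dyadicInterval 2≤Δ
... | v , 2^v<Δ , Δ≤2^[1+v] = map₂ (scaleSum-bound⇒log-bound G degN≥1 {v} 2^v<Δ Δ≤2^[1+v]) (Γ¹-scaleSum G (2 + v))

-- 2 log₂ c ≤ 1 + c

[1+a]^4≤2^[6+a] : ∀ a → suc a ^ 4 ≤ 2 ^ (6 + a)
[1+a]^4≤2^[6+a] 0 = ≤ᵇ⇒≤ _ _ _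
[1+a]^4≤2^[6+a] 1 = ≤ᵇ⇒≤ _ _ _
[1+a]^4≤2^[6+a] 2 = ≤ᵇ⇒≤ _ _ _
[1+a]^4≤2^[6+a] 3 = ≤ᵇ⇒≤ _ _ _
[1+a]^4≤2^[6+a] 4 = ≤ᵇ⇒≤ _ _ _
[1+a]^4≤2^[6+a] 5 = ≤ᵇ⇒≤ _ _ _
[1+a]^4≤2^[6+a] (suc a@(suc (suc (suc (suc (suc b)))))) = begin
  (7 + b) ^ 4         ≤⟨ m≤m+n ((7 + b) ^ 4) _ ⟩
  (7 + b) ^ 4 + _     ≡⟨ twice-[6+b]^4 b ⟨
  2 * (6 + b) ^ 4     ≤⟨ *-monoʳ-≤ 2 ([1+a]^4≤2^[6+a] a) ⟩
  2 * 2 ^ (6 + a)     ∎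
  where
  open ≤-Reasoning
  -- the powers are unfolded because the ring solver does not accept _^_ on ℕ
  twice-[6+b]^4 : ∀ b → 2 * ((6 + b) * ((6 + b) * ((6 + b) * ((6 + b) * 1))))
                     ≡ (7 + b) * ((7 + b) * ((7 + b) * ((7 + b) * 1)))
                       + (b * b * b * b + 20 * (b * b * b) + 138 * (b * b) + 356 * b + 191)
  twice-[6+b]^4 = solve-∀

p^2q≤q^2q*2^[p+q] : ∀ p q → 0 < q → p ^ (2 * q) ≤ q ^ (2 * q) * 2 ^ (p + q)
p^2q≤q^2q*2^[p+q] p q@(suc _) _ = ^-cancelʳ-≤ 2 (*-cancelˡ-≤ (2 ^ (4 * q)) {{m^n≢0 2 (4 * q)}} (begin
  2 ^ (4 * q) * (p ^ (2 * q)) ^ 2             ≡⟨ cong (2 ^ (4 * q) *_) (^-*-assoc p (2 * q) 2) ⟩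
  2 ^ (4 * q) * p ^ (2 * q * 2)               ≡⟨ cong (λ e → 2 ^ (4 * q) * p ^ e) (2*q*2≡4*q q) ⟩
  2 ^ (4 * q) * p ^ (4 * q)                   ≡⟨ ^-distribʳ-* 2 p (4 * q) ⟨
  (2 * p) ^ (4 * q)                           ≤⟨ ^-monoˡ-≤ (4 * q) (<⇒≤ 2p<[1+a]q) ⟩
  (suc a * q) ^ (4 * q)                       ≡⟨ ^-distribʳ-* (suc a) q (4 * q) ⟩
  suc a ^ (4 * q) * q ^ (4 * q)               ≡⟨ cong (_* q ^ (4 * q)) (^-*-assoc (suc a) 4 q) ⟨
  (suc a ^ 4) ^ q * q ^ (4 * q)               ≤⟨ *-monoˡ-≤ (q ^ (4 * q)) (^-monoˡ-≤ q ([1+a]^4≤2^[6+a] a)) ⟩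
  (2 ^ (6 + a)) ^ q * q ^ (4 * q)             ≡⟨ cong (_* q ^ (4 * q)) (^-*-assoc 2 (6 + a) q) ⟩
  2 ^ ((6 + a) * q) * q ^ (4 * q)             ≤⟨ *-monoˡ-≤ (q ^ (4 * q)) (^-monoʳ-≤ 2 [6+a]q≤) ⟩
  2 ^ (4 * q + 2 * (p + q)) * q ^ (4 * q)     ≡⟨ cong (_* q ^ (4 * q)) (^-distribˡ-+-* 2 (4 * q) (2 * (p + q))) ⟩
  2 ^ (4 * q) * 2 ^ (2 * (p + q)) * q ^ (4 * q) ≡⟨ xy∙z≈x∙zy (2 ^ (4 * q)) (2 ^ (2 * (p + q))) (q ^ (4 * q)) ⟩
  2 ^ (4 * q) * (q ^ (4 * q) * 2 ^ (2 * (p + q))) ≡⟨ cong (2 ^ (4 * q) *_) squared ⟨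
  2 ^ (4 * q) * (q ^ (2 * q) * 2 ^ (p + q)) ^ 2 ∎))
  where
  open ≤-Reasoning
  a : ℕ
  a = 2 * p / q
  2*q*2≡4*q : ∀ q → 2 * q * 2 ≡ 4 * q
  2*q*2≡4*q = solve-∀
  2p<[1+a]q : 2 * p < suc a * q
  2p<[1+a]q = begin-strict
    2 * p               ≡⟨ m≡m%n+[m/n]*n (2 * p) q ⟩
    2 * p % q + a * q   <⟨ +-monoˡ-< (a * q) (m%n<n (2 * p) q) ⟩
    q + a * q           ∎
  [6+a]q≤ : (6 + a) * q ≤ 4 * q + 2 * (p + q)
  [6+a]q≤ = begin
    (6 + a) * q        ≡⟨ *-distribʳ-+ q 6 a ⟩
    6 * q + a * q      ≤⟨ +-monoʳ-≤ (6 * q) (m/n*n≤m (2 * p) q) ⟩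
    6 * q + 2 * p      ≡⟨ regroup p q ⟩
    4 * q + 2 * (p + q) ∎
    where
    regroup : ∀ p q → 6 * q + 2 * p ≡ 4 * q + 2 * (p + q)
    regroup = solve-∀
  squared : (q ^ (2 * q) * 2 ^ (p + q)) ^ 2 ≡ q ^ (4 * q) * 2 ^ (2 * (p + q))
  squared = begin-equality
    (q ^ (2 * q) * 2 ^ (p + q)) ^ 2         ≡⟨ ^-distribʳ-* (q ^ (2 * q)) (2 ^ (p + q)) 2 ⟩
    (q ^ (2 * q)) ^ 2 * (2 ^ (p + q)) ^ 2   ≡⟨ cong₂ _*_ (^-*-assoc q (2 * q) 2) (^-*-assoc 2 (p + q) 2) ⟩
    q ^ (2 * q * 2) * 2 ^ ((p + q) * 2)     ≡⟨ cong₂ (λ x y → q ^ x * 2 ^ y) (2*q*2≡4*q q) (*-comm (p + q) 2) ⟩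
    q ^ (4 * q) * 2 ^ (2 * (p + q))         ∎

ratioBound : ∀ p q n g Δ → 0 < q → 2 ^ n ≤ Δ ^ (4 * g) →
  p ^ (q * n) ≤ q ^ (q * n) * Δ ^ (2 * (p + q) * g)
ratioBound p q n g Δ 0<q 2^n≤ = ^-cancelʳ-≤ 2 (begin
  (p ^ (q * n)) ^ 2                                 ≡⟨ ^-regroup p (q * n) 2 (2 * q) n (xy∙z≈zx∙y q n 2) ⟩
  (p ^ (2 * q)) ^ n                                 ≤⟨ ^-monoˡ-≤ n (p^2q≤q^2q*2^[p+q] p q 0<q) ⟩
  (q ^ (2 * q) * 2 ^ (p + q)) ^ n                   ≡⟨ ^-distribʳ-* (q ^ (2 * q)) (2 ^ (p + q)) n ⟩
  (q ^ (2 * q)) ^ n * (2 ^ (p + q)) ^ n             ≡⟨ cong ((q ^ (2 * q)) ^ n *_) (^-regroup 2 (p + q) n n (p + q) (*-comm (p + q) n)) ⟩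
  (q ^ (2 * q)) ^ n * (2 ^ n) ^ (p + q)             ≤⟨ *-monoʳ-≤ ((q ^ (2 * q)) ^ n) (^-monoˡ-≤ (p + q) 2^n≤) ⟩
  (q ^ (2 * q)) ^ n * (Δ ^ (4 * g)) ^ (p + q)       ≡⟨ cong₂ _*_ (^-regroup q (2 * q) n (q * n) 2 (xy∙z≈yz∙x 2 q n))
                                                                 (^-regroup Δ (4 * g) (p + q) (2 * (p + q) * g) 2 (exponent g p q)) ⟩
  (q ^ (q * n)) ^ 2 * (Δ ^ (2 * (p + q) * g)) ^ 2   ≡⟨ ^-distribʳ-* (q ^ (q * n)) (Δ ^ (2 * (p + q) * g)) 2 ⟨
  (q ^ (q * n) * Δ ^ (2 * (p + q) * g)) ^ 2         ∎)
  where
  open ≤-Reasoning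
  ^-regroup : ∀ x a b c d → a * b ≡ c * d → (x ^ a) ^ b ≡ (x ^ c) ^ d
  ^-regroup x a b c d eq = trans (^-*-assoc x a b) (trans (cong (x ^_) eq) (sym (^-*-assoc x c d)))
  exponent : ∀ g p q → 4 * g * (p + q) ≡ 2 * (p + q) * g * 2
  exponent = solve-∀

corollaryA6 : (s n : ℕ) (G : BipGraph s n) → NoIsolated G → 2 ≤ maxDeg G →
    (p q : ℕ) → 0 < q → q < p →
    Σ (Subset s) (λ S' → p ^ (q * n) ≤ q ^ (q * n) * maxDeg G ^ (2 * (p + q) * Γ¹-card G S'))
corollaryA6 s n G (_ , degN≥1) 2≤Δ p q 0<q _ =
  map₂ (λ {S'} → ratioBound p q n (Γ¹-card G S') (maxDeg G) 0<q) (Γ¹-log-bound G degN≥1 2≤Δ)
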